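{- Let $G$ be a connected $(2K_2, K_1+C_4)$-free graph. Then either $G$ is a pseudo-split graph, or there exists a partition $(V_1, \ldots, V_6)$ of $V(G)$ (some parts possibly empty) such that (i) either $G[V_1]$ is a pseudo-split graph with $\omega(G[V_1]) \leq \omega(G)-1$ and $V_5 = V_6 = \emptyset$, or $G[V_1]$ is the complement of a bipartite graph; and (ii) $V_i$ is an independent set for each $i \in \{2, \ldots, 6\}$.
   Context: All graphs are finite, simple and undirected. $C_4$ is the cycle on $4$ vertices, $K_n$ the complete graph on $n$ vertices, $2K_2$ the disjoint union of two edges, and $K_1+C_4$ is $C_4$ together with a vertex adjacent to all four of its vertices. A graph is $\mathcal{F}$-free if it has no induced subgraph isomorphic to a member of $\mathcal{F}$. A pseudo-split graph is a $(2K_2, C_4)$-free graph. $G[S]$ is the subgraph induced by $S$, and $\omega$ denotes the clique number. -}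

module Defs where

open import Data.Nat using (ℕ; suc; _≤_; _∸_)
open import Data.Fin using (Fin; zero; suc; _≟_)
open import Data.Bool using (Bool; true; false; not; _∨_)
open import Data.Product using (Σ; ∃; _×_; _,_)
open import Data.Sum using (_⊎_)
open import Data.Unit using (⊤)
open import Relation.Nullary using (¬_)
open import Relation.Nullary.Decidable using (⌊_⌋)
open import Relation.Binary.PropositionalEquality using (_≡_; _≢_)
open import Function.Definitions using (Injective)

record Graph (n : ℕ) : Set where
  field
    adj     : Fin n → Fin n → Bool
    adj-sym : ∀ u v → adj u v ≡ adj v u
    loopless : ∀ v → adj v v ≡ false
open Graph public

VSet : ℕ → Set₁
VSet n = Fin n → Set

Everything : (n : ℕ) → VSet n
Everything n _ = ⊤

complement : ∀ {n} → Graph n → Graph n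
complement {n} G = record
  { adj = λ u v → not (⌊ u ≟ v ⌋ ∨ adj G u v)
  ; adj-sym = sym'
  ; loopless = loop' }
  where
  open import Relation.Binary.PropositionalEquality using (refl; cong₂; cong)
  open import Relation.Nullary using (yes; no)
  open import Relation.Binary.PropositionalEquality using (sym)
  eqsym : ∀ (u v : Fin n) → ⌊ u ≟ v ⌋ ≡ ⌊ v ≟ u ⌋
  eqsym u v with u ≟ v | v ≟ u
  ... | yes _ | yes _ = refl
  ... | no _  | no _  = refl
  ... | yes p | no q  = Data.Empty.⊥-elim (q (sym p))
    where import Data.Empty
  ... | no p  | yes q = Data.Empty.⊥-elim (p (sym q))
    where import Data.Empty
  sym' : ∀ u v → not (⌊ u ≟ v ⌋ ∨ adj G u v) ≡ not (⌊ v ≟ u ⌋ ∨ adj G v u)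
  sym' u v = cong not (cong₂ _∨_ (eqsym u v) (adj-sym G u v))
  loop' : ∀ v → not (⌊ v ≟ v ⌋ ∨ adj G v v) ≡ false
  loop' v with v ≟ v
  ... | yes _ = refl
  ... | no ¬p = Data.Empty.⊥-elim (¬p refl)
    where import Data.Empty

InducedIn : ∀ {n k} → Graph n → VSet n → (Fin k → Fin k → Bool) → Set
InducedIn {n} {k} G S H =
  Σ (Fin k → Fin n) λ f →
    Injective _≡_ _≡_ f × (∀ i → S (f i)) × (∀ i j → adj G (f i) (f j) ≡ H i j)

FreeOn : ∀ {n k} → Graph n → VSet n → (Fin k → Fin k → Bool) → Set
FreeOn G S H = ¬ InducedIn G S H

2K2 : Fin 4 → Fin 4 → Bool
2K2 zero (suc zero) = true
2K2 (suc zero) zero = true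
2K2 (suc (suc zero)) (suc (suc (suc zero))) = true
2K2 (suc (suc (suc zero))) (suc (suc zero)) = true
2K2 _ _ = false

C4 : Fin 4 → Fin 4 → Bool
C4 zero (suc zero) = true
C4 (suc zero) zero = true
C4 (suc zero) (suc (suc zero)) = true
C4 (suc (suc zero)) (suc zero) = true
C4 (suc (suc zero)) (suc (suc (suc zero))) = true
C4 (suc (suc (suc zero))) (suc (suc zero)) = true
C4 (suc (suc (suc zero))) zero = true
C4 zero (suc (suc (suc zero))) = true
C4 _ _ = false

-- K1 + C4 : C4 on vertices 0..3 plus vertex 4 adjacent to all of them
K1+C4 : Fin 5 → Fin 5 → Bool
K1+C4 (suc (suc (suc (suc zero)))) (suc (suc (suc (suc zero)))) = false
K1+C4 (suc (suc (suc (suc zero)))) _ = true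
K1+C4 _ (suc (suc (suc (suc zero)))) = true
K1+C4 zero (suc zero) = true
K1+C4 (suc zero) zero = true
K1+C4 (suc zero) (suc (suc zero)) = true
K1+C4 (suc (suc zero)) (suc zero) = true
K1+C4 (suc (suc zero)) (suc (suc (suc zero))) = true
K1+C4 (suc (suc (suc zero))) (suc (suc zero)) = true
K1+C4 (suc (suc (suc zero))) zero = true
K1+C4 zero (suc (suc (suc zero))) = true
K1+C4 _ _ = false

K : (k : ℕ) → Fin k → Fin k → Bool
K k i j = not ⌊ i ≟ j ⌋

PseudoSplitOn : ∀ {n} → Graph n → VSet n → Set
PseudoSplitOn G S = FreeOn G S 2K2 × FreeOn G S C4

PseudoSplit : ∀ {n} → Graph n → Set
PseudoSplit {n} G = PseudoSplitOn G (Everything n)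

CliqueNumberOn : ∀ {n} → Graph n → VSet n → ℕ → Set
CliqueNumberOn G S w = InducedIn G S (K w) × ¬ InducedIn G S (K (suc w))

BipartiteOn : ∀ {n} → Graph n → VSet n → Set
BipartiteOn {n} G S =
  Σ (Fin n → Bool) λ c → ∀ u v → S u → S v → adj G u v ≡ true → c u ≢ c v

IndependentOn : ∀ {n} → Graph n → VSet n → Set
IndependentOn G S = ∀ u v → S u → S v → adj G u v ≡ false

data Reach {n} (G : Graph n) : Fin n → Fin n → Set where
  here : ∀ {u} → Reach G u u
  step : ∀ {u w v} → adj G u w ≡ true → Reach G w v → Reach G u v

Connected : ∀ {n} → Graph n → Set
Connected G = ∀ u v → Reach G u v

Part : ∀ {n} → (Fin n → Fin 6) → Fin 6 → VSet n
Part p i v = p v ≡ i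

-- The neighbourhood of any vertex of a (2K2, K1+C4)-free graph is pseudo-split, and a pseudo-split
-- graph splits into a clique K and two independent sets.  Take K locally maximal: no outside vertex
-- is adjacent to all of K, and no two adjacent outside vertices miss the same single vertex of K
-- (else trade that vertex for both).  For adjacent outside vertices y, z the sets of vertices of K
-- they miss are nested (else a C4) and share at most one vertex (else a 2K2); hence the outside
-- vertices missing exactly one vertex of K are independent, and so are those missing several.
-- Given an edge uv, the vertices adjacent to neither u nor v are independent (else a 2K2), so the
-- cliques of N(u) and N(v) ∖ N(u) form a co-bipartite V1 and the remaining classes give V2, ..., V6.
module Submission where

open import Defs
open import Data.Nat using (ℕ; zero; suc; _≤_; _<_; _∸_; z≤n; s≤s)
open import Data.Nat.Properties using (≤-reflexive; m≤n⇒m≤1+n; ∸-monoʳ-<)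
open import Data.Nat.Induction using (<-wellFounded)
open import Induction.WellFounded using (Acc; acc)
open import Data.Fin using (Fin; zero; suc; _≟_; opposite)
open import Data.Fin.Properties using (any?; all?; ¬∀⟶∃¬; opposite-involutive)
open import Data.Bool using (Bool; true; false; if_then_else_)
open import Data.Bool.Properties using (¬-not) renaming (_≟_ to _≟ᵇ_)
open import Data.Vec using (Vec; []; _∷_; lookup)
open import Data.Vec.Relation.Unary.All using (All; []; _∷_)
open import Data.Vec.Relation.Unary.All.Properties using (lookup⁺)
open import Data.Vec.Relation.Unary.AllPairs using ([]; _∷_)
open import Data.Vec.Relation.Unary.Unique.Propositional using (Unique)
open import Data.Vec.Relation.Unary.Unique.Propositional.Properties using (lookup-injective)
open import Data.Vec.Functional using (updateAt; tail)
open import Data.Vec.Functional.Properties using (updateAt-updates; updateAt-minimal)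
open import Data.Product using (Σ; ∃; ∃₂; _×_; _,_; proj₁; proj₂)
open import Data.Sum using (_⊎_; inj₁; inj₂; [_,_]′; fromInj₂)
open import Data.Empty using (⊥-elim)
open import Data.Unit using (tt)
open import Function using (const)
open import Function.Definitions using (Injective)
open import Relation.Nullary using (¬_; Dec; yes; no; contradiction)
open import Relation.Nullary.Decidable using (from-yes; _×-dec_; _→-dec_; ¬?)
open import Relation.Unary using (Decidable; _⊆_)
open import Relation.Binary.PropositionalEquality using (_≡_; _≢_; refl; sym; trans; cong; subst)

≡true⇒≢false : ∀ {b} → b ≡ true → b ≢ false
≡true⇒≢false refl ()

refute-→ : ∀ {p q} {P : Set p} {Q : Set q} → Dec P → ¬ (P → Q) → P × ¬ Q
refute-→ (yes p) ¬[P→Q] = p , λ q → ¬[P→Q] (λ _ → q)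
refute-→ (no ¬p) ¬[P→Q] = contradiction (λ p → contradiction p ¬p) ¬[P→Q]

module _ {a p q} {A : Set a} {P : A → Set p} {Q : A → Set q} (μ : A → ℕ) (bound : ℕ)
         (bounded : ∀ {x} → P x → μ x ≤ bound)
         (improve : ∀ {x} → P x → Q x ⊎ ∃ λ y → P y × μ x < μ y) where

  bounded-ascent : ∀ {x} → P x → ∃ λ y → P y × Q y
  bounded-ascent px = climb px (<-wellFounded _)
    where
    climb : ∀ {x} → P x → Acc _<_ (bound ∸ μ x) → ∃ λ y → P y × Q y
    climb {x} px (acc rs) with improve px
    ... | inj₁ qx = x , px , qx
    ... | inj₂ (y , py , x<y) = climb py (rs (∸-monoʳ-< x<y (bounded py)))

⟦_⟧ : ∀ {n} → (Fin n → Bool) → VSet n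
⟦ K ⟧ x = K x ≡ true

size : ∀ {n} → (Fin n → Bool) → ℕ
size {zero}  K = 0
size {suc n} K = if K zero then suc (size (tail K)) else size (tail K)

insert delete : ∀ {n} → (Fin n → Bool) → Fin n → Fin n → Bool
insert K y = updateAt K y (const true)
delete K y = updateAt K y (const false)

size≤n : ∀ {n} (K : Fin n → Bool) → size K ≤ n
size≤n {zero}  K = z≤n
size≤n {suc n} K with K zero
... | true  = s≤s (size≤n (tail K))
... | false = m≤n⇒m≤1+n (size≤n (tail K))

size-insert : ∀ {n} (K : Fin n → Bool) y → K y ≡ false → size (insert K y) ≡ suc (size K)
size-insert K zero    Ky rewrite Ky = refl
size-insert K (suc y) Ky rewrite size-insert (tail K) y Ky with K zero
... | true  = refl
... | false = refl

size-delete : ∀ {n} (K : Fin n → Bool) y → K y ≡ true → suc (size (delete K y)) ≡ size K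
size-delete K zero    Ky rewrite Ky = refl
size-delete K (suc y) Ky with K zero | size-delete (tail K) y Ky
... | true  | e = cong suc e
... | false | e = e

∈-insert : ∀ {n} (K : Fin n → Bool) y x → ⟦ insert K y ⟧ x → x ≡ y ⊎ ⟦ K ⟧ x
∈-insert K y x x∈ with x ≟ y
... | yes x≡y = inj₁ x≡y
... | no  x≢y = inj₂ (trans (sym (updateAt-minimal x y K x≢y)) x∈)

∉-insert : ∀ {n} (K : Fin n → Bool) {x y} → x ≢ y → K x ≡ false → insert K y x ≡ false
∉-insert K x≢y Kx = trans (updateAt-minimal _ _ K x≢y) Kx

∈-delete : ∀ {n} (K : Fin n → Bool) y x → ⟦ delete K y ⟧ x → x ≢ y × ⟦ K ⟧ x
∈-delete K y x x∈ with x ≟ y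
... | yes refl = contradiction (trans (sym (updateAt-updates y K)) x∈) λ ()
... | no  x≢y = x≢y , trans (sym (updateAt-minimal x y K x≢y)) x∈

∉-delete : ∀ {n} (K : Fin n → Bool) y x → K x ≡ false → delete K y x ≡ false
∉-delete K y x Kx with x ≟ y
... | yes refl = updateAt-updates y K
... | no  x≢y = trans (updateAt-minimal x y K x≢y) Kx

CliqueOn : ∀ {n} → Graph n → VSet n → Set
CliqueOn G S = ∀ u v → S u → S v → u ≢ v → adj G u v ≡ true

Neighbourhood : ∀ {n} → Graph n → Fin n → VSet n
Neighbourhood G u v = adj G u v ≡ true

module _ {n} (G : Graph n) where

  adj-flip : ∀ {x y b} → adj G x y ≡ b → adj G y x ≡ b
  adj-flip {x} {y} = trans (adj-sym G y x)

  adj⇒≢ : ∀ {x y} → adj G x y ≡ true → x ≢ y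
  adj⇒≢ {x} xy refl = ≡true⇒≢false xy (loopless G x)

  adj-separates : ∀ {x y w} → adj G x w ≡ true → adj G y w ≡ false → x ≢ y
  adj-separates xw yw refl = ≡true⇒≢false xw yw

  complement-adj : ∀ {x y} → adj (complement G) x y ≡ true → x ≢ y × adj G x y ≡ false
  complement-adj {x} {y} e with x ≟ y | adj G x y
  complement-adj {x} {y} () | yes _   | _
  complement-adj {x} {y} () | no _    | true
  complement-adj {x} {y} _  | no x≢y  | false = x≢y , refl

  FreeOn-anti : ∀ {k} {S T : VSet n} {H : Fin k → Fin k → Bool} → S ⊆ T → FreeOn G T H → FreeOn G S H
  FreeOn-anti S⊆T free (f , inj , inS , table) = free (f , inj , (λ i → S⊆T (inS i)) , table)

  InducedIn-relabel : ∀ {k} {S : VSet n} {H H′ : Fin k → Fin k → Bool} (σ : Fin k → Fin k)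
                    → Injective _≡_ _≡_ σ → (∀ i j → H (σ i) (σ j) ≡ H′ i j)
                    → InducedIn G S H → InducedIn G S H′
  InducedIn-relabel σ σ-inj relabel (f , f-inj , inS , table) =
    (λ i → f (σ i)) , (λ e → σ-inj (f-inj e)) , (λ i → inS (σ i)) ,
    (λ i j → trans (table (σ i) (σ j)) (relabel i j))

  induced : ∀ {k} {S : VSet n} (H : Fin k → Fin k → Bool) (xs : Vec (Fin n) k) → Unique xs → All S xs
          → (∀ i j → adj G (lookup xs i) (lookup xs j) ≡ H i j) → InducedIn G S H
  induced H xs distinct inS table = lookup xs , lookup-injective distinct _ _ , lookup⁺ inS , table

  2K2-induced : ∀ {S : VSet n} {a b c d} → S a → S b → S c → S d
              → adj G a b ≡ true → adj G c d ≡ true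
              → adj G a c ≡ false → adj G a d ≡ false → adj G b c ≡ false → adj G b d ≡ false
              → InducedIn G S 2K2
  2K2-induced {a = a} {b} {c} {d} sa sb sc sd ab cd ac ad bc bd =
    induced 2K2 (a ∷ b ∷ c ∷ d ∷ []) distinct (sa ∷ sb ∷ sc ∷ sd ∷ []) table
    where
    distinct : Unique (a ∷ b ∷ c ∷ d ∷ [])
    distinct = (adj⇒≢ ab ∷ adj-separates ab (adj-flip bc) ∷ adj-separates ab (adj-flip bd) ∷ [])
             ∷ (adj-separates (adj-flip ab) (adj-flip ac) ∷ adj-separates (adj-flip ab) (adj-flip ad) ∷ [])
             ∷ (adj⇒≢ cd ∷ [])
             ∷ [] ∷ []
    table : ∀ i j → adj G (lookup (a ∷ b ∷ c ∷ d ∷ []) i) (lookup (a ∷ b ∷ c ∷ d ∷ []) j) ≡ 2K2 i j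
    table zero                   zero                   = loopless G a
    table zero                   (suc zero)             = ab
    table zero                   (suc (suc zero))       = ac
    table zero                   (suc (suc (suc zero))) = ad
    table (suc zero)             zero                   = adj-flip ab
    table (suc zero)             (suc zero)             = loopless G b
    table (suc zero)             (suc (suc zero))       = bc
    table (suc zero)             (suc (suc (suc zero))) = bd
    table (suc (suc zero))       zero                   = adj-flip ac
    table (suc (suc zero))       (suc zero)             = adj-flip bc
    table (suc (suc zero))       (suc (suc zero))       = loopless G c
    table (suc (suc zero))       (suc (suc (suc zero))) = cd
    table (suc (suc (suc zero))) zero                   = adj-flip ad
    table (suc (suc (suc zero))) (suc zero)             = adj-flip bd
    table (suc (suc (suc zero))) (suc (suc zero))       = adj-flip cd
    table (suc (suc (suc zero))) (suc (suc (suc zero))) = loopless G d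

  C4-induced : ∀ {S : VSet n} {a b c d} → a ≢ c → b ≢ d → S a → S b → S c → S d
             → adj G a b ≡ true → adj G b c ≡ true → adj G c d ≡ true → adj G d a ≡ true
             → adj G a c ≡ false → adj G b d ≡ false
             → InducedIn G S C4
  C4-induced {a = a} {b} {c} {d} a≢c b≢d sa sb sc sd ab bc cd da ac bd =
    induced C4 (a ∷ b ∷ c ∷ d ∷ []) distinct (sa ∷ sb ∷ sc ∷ sd ∷ []) table
    where
    distinct : Unique (a ∷ b ∷ c ∷ d ∷ [])
    distinct = (adj⇒≢ ab ∷ a≢c ∷ adj⇒≢ (adj-flip da) ∷ [])
             ∷ (adj⇒≢ bc ∷ b≢d ∷ [])
             ∷ (adj⇒≢ cd ∷ [])
             ∷ [] ∷ []
    table : ∀ i j → adj G (lookup (a ∷ b ∷ c ∷ d ∷ []) i) (lookup (a ∷ b ∷ c ∷ d ∷ []) j) ≡ C4 i j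
    table zero                   zero                   = loopless G a
    table zero                   (suc zero)             = ab
    table zero                   (suc (suc zero))       = ac
    table zero                   (suc (suc (suc zero))) = adj-flip da
    table (suc zero)             zero                   = adj-flip ab
    table (suc zero)             (suc zero)             = loopless G b
    table (suc zero)             (suc (suc zero))       = bc
    table (suc zero)             (suc (suc (suc zero))) = bd
    table (suc (suc zero))       zero                   = adj-flip ac
    table (suc (suc zero))       (suc zero)             = adj-flip bc
    table (suc (suc zero))       (suc (suc zero))       = loopless G c
    table (suc (suc zero))       (suc (suc (suc zero))) = cd
    table (suc (suc (suc zero))) zero                   = da
    table (suc (suc (suc zero))) (suc zero)             = adj-flip bd
    table (suc (suc (suc zero))) (suc (suc zero))       = adj-flip cd
    table (suc (suc (suc zero))) (suc (suc (suc zero))) = loopless G d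

cone : ∀ {k} → (Fin k → Fin k → Bool) → Fin (suc k) → Fin (suc k) → Bool
cone H zero    zero    = false
cone H zero    (suc j) = true
cone H (suc i) zero    = true
cone H (suc i) (suc j) = H i j

-- K1+C4 lists its apex last, the cone over C4 first.
cone-C4≡K1+C4 : ∀ i j → cone C4 (opposite i) (opposite j) ≡ K1+C4 i j
cone-C4≡K1+C4 = from-yes (all? λ i → all? λ j → cone C4 (opposite i) (opposite j) ≟ᵇ K1+C4 i j)

opposite-injective : ∀ {k} → Injective _≡_ _≡_ (opposite {k})
opposite-injective {x = i} {j} e =
  trans (sym (opposite-involutive i)) (trans (cong opposite e) (opposite-involutive j))

module _ {n} (G : Graph n) where

  cone-induced : ∀ {k} {H : Fin k → Fin k → Bool} u
               → InducedIn G (Neighbourhood G u) H → InducedIn G (Everything n) (cone H)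
  cone-induced {k} {H} u (f , f-inj , inN , table) = g , g-inj , (λ _ → tt) , g-table
    where
    g : Fin (suc k) → Fin n
    g zero    = u
    g (suc i) = f i
    g-inj : Injective _≡_ _≡_ g
    g-inj {zero}  {zero}  _ = refl
    g-inj {zero}  {suc j} e = contradiction e (adj⇒≢ G (inN j))
    g-inj {suc i} {zero}  e = contradiction (sym e) (adj⇒≢ G (inN i))
    g-inj {suc i} {suc j} e = cong suc (f-inj e)
    g-table : ∀ i j → adj G (g i) (g j) ≡ cone H i j
    g-table zero    zero    = loopless G u
    g-table zero    (suc j) = inN j
    g-table (suc i) zero    = adj-flip G (inN i)
    g-table (suc i) (suc j) = table i j

  neighbourhood-pseudoSplit : FreeOn G (Everything n) 2K2 → FreeOn G (Everything n) K1+C4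
                            → ∀ u → PseudoSplitOn G (Neighbourhood G u)
  neighbourhood-pseudoSplit free2K2 freeK1+C4 u =
    FreeOn-anti G {S = Neighbourhood G u} {T = Everything n} (λ _ → tt) free2K2 ,
    λ c4 → freeK1+C4 (InducedIn-relabel G {S = Everything n} opposite opposite-injective cone-C4≡K1+C4 (cone-induced u c4))

record TwoOnePartition {n} (G : Graph n) (S : VSet n) : Set where
  field
    class        : Fin n → Fin 3
    clique       : CliqueOn G (λ x → S x × class x ≡ zero)
    independent₁ : IndependentOn G (λ x → S x × class x ≡ suc zero)
    independent₂ : IndependentOn G (λ x → S x × class x ≡ suc (suc zero))

layer : ∀ {p} {P : Set p} → Bool → Dec P → Fin 3
layer true  _       = zero
layer false (yes _) = suc zero
layer false (no _)  = suc (suc zero)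

layer-0 : ∀ {p} {P : Set p} b (d : Dec P) → layer b d ≡ zero → b ≡ true
layer-0 true  _       _ = refl
layer-0 false (yes _) ()
layer-0 false (no _)  ()

layer-1 : ∀ {p} {P : Set p} b (d : Dec P) → layer b d ≡ suc zero → b ≡ false × P
layer-1 true  _       ()
layer-1 false (yes p) _ = refl , p
layer-1 false (no _)  ()

layer-2 : ∀ {p} {P : Set p} b (d : Dec P) → layer b d ≡ suc (suc zero) → b ≡ false × ¬ P
layer-2 true  _       ()
layer-2 false (yes _) ()
layer-2 false (no ¬p) _ = refl , ¬p

module _ {n} (G : Graph n) {S : VSet n} (S? : Decidable S) where

  CliqueIn : (Fin n → Bool) → Set
  CliqueIn K = ⟦ K ⟧ ⊆ S × CliqueOn G ⟦ K ⟧

  AdjacentToAll : (Fin n → Bool) → Fin n → Set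
  AdjacentToAll K y = ∀ k → ⟦ K ⟧ k → adj G y k ≡ true

  AdjacentToAllBut : (Fin n → Bool) → Fin n → Fin n → Set
  AdjacentToAllBut K k y = ∀ k′ → ⟦ K ⟧ k′ → k′ ≢ k → adj G y k′ ≡ true

  Extendable : (Fin n → Bool) → Set
  Extendable K = ∃ λ y → S y × K y ≡ false × AdjacentToAll K y

  Swappable : (Fin n → Bool) → Set
  Swappable K = ∃ λ k → ⟦ K ⟧ k × ∃₂ λ y z →
    (S y × K y ≡ false × AdjacentToAllBut K k y) × (S z × K z ≡ false × AdjacentToAllBut K k z) × adj G y z ≡ true

  extendable? : Decidable Extendable
  extendable? K = any? λ y → S? y ×-dec (K y ≟ᵇ false) ×-dec all? λ k → (K k ≟ᵇ true) →-dec (adj G y k ≟ᵇ true)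

  swappable? : Decidable Swappable
  swappable? K = any? λ k → (K k ≟ᵇ true) ×-dec any? λ y → any? λ z →
    candidate? k y ×-dec candidate? k z ×-dec (adj G y z ≟ᵇ true)
    where
    candidate? : ∀ k y → Dec (S y × K y ≡ false × AdjacentToAllBut K k y)
    candidate? k y = S? y ×-dec (K y ≟ᵇ false) ×-dec
      all? λ k′ → (K k′ ≟ᵇ true) →-dec (¬? (k′ ≟ k) →-dec (adj G y k′ ≟ᵇ true))

  insert-clique : ∀ {K y} → CliqueIn K → S y → AdjacentToAll K y → CliqueIn (insert K y)
  insert-clique {K} {y} (K⊆S , clique) sy y~K = ⊆S , clique′
    where
    ⊆S : ⟦ insert K y ⟧ ⊆ S
    ⊆S {x} x∈ with ∈-insert K y x x∈
    ... | inj₁ refl = sy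
    ... | inj₂ x∈K  = K⊆S x∈K
    clique′ : CliqueOn G ⟦ insert K y ⟧
    clique′ x x′ x∈ x′∈ x≢x′ with ∈-insert K y x x∈ | ∈-insert K y x′ x′∈
    ... | inj₁ refl | inj₁ refl = contradiction refl x≢x′
    ... | inj₁ refl | inj₂ x′∈K = y~K x′ x′∈K
    ... | inj₂ x∈K  | inj₁ refl = adj-flip G (y~K x x∈K)
    ... | inj₂ x∈K  | inj₂ x′∈K = clique x x′ x∈K x′∈K x≢x′

  delete-clique : ∀ {K} k → CliqueIn K → CliqueIn (delete K k)
  delete-clique {K} k (K⊆S , clique) =
    (λ {x} x∈ → K⊆S (proj₂ (∈-delete K k x x∈))) ,
    (λ x x′ x∈ x′∈ → clique x x′ (proj₂ (∈-delete K k x x∈)) (proj₂ (∈-delete K k x′ x′∈)))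

  swap-clique : ∀ {K} → CliqueIn K → Swappable K → ∃ λ K′ → CliqueIn K′ × size K < size K′
  swap-clique {K} cl (k , k∈K , y , z , (sy , Ky , y~K-k) , (sz , Kz , z~K-k) , yz) =
    insert K₁ z , insert-clique (insert-clique (delete-clique k cl) sy y~K₀) sz z~K₁ , ≤-reflexive (sym grows)
    where
    K₀ K₁ : Fin n → Bool
    K₀ = delete K k
    K₁ = insert K₀ y
    y~K₀ : AdjacentToAll K₀ y
    y~K₀ x x∈ = let (x≢k , x∈K) = ∈-delete K k x x∈ in y~K-k x x∈K x≢k
    z~K₁ : AdjacentToAll K₁ z
    z~K₁ x x∈ with ∈-insert K₀ y x x∈
    ... | inj₁ refl = adj-flip G yz
    ... | inj₂ x∈K₀ = let (x≢k , x∈K) = ∈-delete K k x x∈K₀ in z~K-k x x∈K x≢k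
    grows : size (insert K₁ z) ≡ suc (size K)
    grows = trans (size-insert K₁ z (∉-insert K₀ (adj⇒≢ G (adj-flip G yz)) (∉-delete K k z Kz)))
                  (cong suc (trans (size-insert K₀ y (∉-delete K k y Ky)) (size-delete K k k∈K)))

  improve : ∀ {K} → CliqueIn K → (¬ Extendable K × ¬ Swappable K) ⊎ ∃ λ K′ → CliqueIn K′ × size K < size K′
  improve {K} cl with extendable? K
  ... | yes (y , sy , Ky , y~K) = inj₂ (insert K y , insert-clique cl sy y~K , ≤-reflexive (sym (size-insert K y Ky)))
  ... | no ¬ext with swappable? K
  ... | yes sw  = inj₂ (swap-clique cl sw)
  ... | no ¬swp = inj₁ (¬ext , ¬swp)

  locallyMaximalClique : ∃ λ K → CliqueIn K × ¬ Extendable K × ¬ Swappable K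
  locallyMaximalClique =
    bounded-ascent size n (λ {K} _ → size≤n K) improve {const false} ((λ ()) , (λ _ _ ()))

  module LocallyMaximal (pseudoSplit : PseudoSplitOn G S) {K : Fin n → Bool} (K-clique : CliqueIn K)
                        (¬extendable : ¬ Extendable K) (¬swappable : ¬ Swappable K) where

    private
      K⊆S : ⟦ K ⟧ ⊆ S
      K⊆S = proj₁ K-clique

      K-complete : CliqueOn G ⟦ K ⟧
      K-complete = proj₂ K-clique

    Outside : VSet n
    Outside y = S y × K y ≡ false

    Misses : Fin n → Fin n → Set
    Misses y k = ⟦ K ⟧ k × adj G y k ≡ false

    misses? : ∀ y k → Dec (Misses y k)
    misses? y k = (K k ≟ᵇ true) ×-dec (adj G y k ≟ᵇ false)

    MissesOnly : Fin n → Fin n → Set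
    MissesOnly y k = Misses y k × ∀ k′ → Misses y k′ → k′ ≡ k

    missesOnly? : ∀ y → Dec (∃ (MissesOnly y))
    missesOnly? y = any? λ k → misses? y k ×-dec all? λ k′ → misses? y k′ →-dec (k′ ≟ k)

    misses-some : ∀ {y} → Outside y → ∃ (Misses y)
    misses-some {y} (sy , Ky) =
      let k , ¬[k∈K→y~k] = ¬∀⟶∃¬ n _ (λ k → (K k ≟ᵇ true) →-dec (adj G y k ≟ᵇ true))
                                       (λ y~K → ¬extendable (y , sy , Ky , y~K))
          k∈K , ¬y~k = refute-→ (K k ≟ᵇ true) ¬[k∈K→y~k]
      in k , k∈K , ¬-not ¬y~k

    misses-another : ∀ {y a} → ¬ ∃ (MissesOnly y) → Misses y a → ∃ λ b → Misses y b × b ≢ a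
    misses-another {y} {a} ¬only ya =
      let b , ¬[yb→b≡a] = ¬∀⟶∃¬ n _ (λ b → misses? y b →-dec (b ≟ a)) (λ only-a → ¬only (a , ya , only-a))
      in b , refute-→ (misses? y b) ¬[yb→b≡a]

    missesOnly⇒adjacentToAllBut : ∀ {y k} → MissesOnly y k → AdjacentToAllBut K k y
    missesOnly⇒adjacentToAllBut (_ , only-k) k′ k′∈K k′≢k = ¬-not λ yk′ → k′≢k (only-k k′ (k′∈K , yk′))

    misses-cross : ∀ {y z a b} → Outside y → Outside z → adj G y z ≡ true
                 → Misses y a → Misses z b → Misses z a ⊎ Misses y b
    misses-cross {y} {z} {a} {b} (sy , Ky) (sz , Kz) yz (a∈K , ya) (b∈K , zb)
      with adj G z a in za | adj G y b in yb
    ... | false | _     = inj₁ (a∈K , refl)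
    ... | true  | false = inj₂ (b∈K , refl)
    ... | true  | true  = ⊥-elim (proj₂ pseudoSplit
          (C4-induced G y≢a z≢b sy sz (K⊆S a∈K) (K⊆S b∈K) yz za (K-complete a b a∈K b∈K a≢b) (adj-flip G yb) ya zb))
      where
      y≢a : y ≢ a
      y≢a refl = ≡true⇒≢false a∈K Ky
      z≢b : z ≢ b
      z≢b refl = ≡true⇒≢false b∈K Kz
      a≢b : a ≢ b
      a≢b refl = ≡true⇒≢false yb ya

    common-miss-unique : ∀ {y z a b} → Outside y → Outside z → adj G y z ≡ true
                       → Misses y a → Misses z a → Misses y b → Misses z b → a ≡ b
    common-miss-unique {a = a} {b} (sy , _) (sz , _) yz (a∈K , ya) (_ , za) (b∈K , yb) (_ , zb) with a ≟ b
    ... | yes a≡b = a≡b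
    ... | no  a≢b = ⊥-elim (proj₁ pseudoSplit
          (2K2-induced G sy sz (K⊆S a∈K) (K⊆S b∈K) yz (K-complete a b a∈K b∈K a≢b) ya yb za zb))

    misses-nested : ∀ {y z} → Outside y → Outside z → adj G y z ≡ true
                  → (∀ a → Misses y a → Misses z a) ⊎ (∀ b → Misses z b → Misses y b)
    misses-nested {y} {z} oy oz yz with all? (λ a → misses? y a →-dec misses? z a)
    ... | yes y⊆z = inj₁ y⊆z
    ... | no  y⊈z =
      let a , ¬[ya→za] = ¬∀⟶∃¬ n _ (λ a → misses? y a →-dec misses? z a) y⊈z
          ya , ¬za = refute-→ (misses? y a) ¬[ya→za]
      in inj₂ λ b zb → fromInj₂ (λ za → contradiction za ¬za) (misses-cross oy oz yz ya zb)

    missesOnly-independent : ∀ {y z k k′} → Outside y → Outside z → MissesOnly y k → MissesOnly z k′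
                           → adj G y z ≡ false
    missesOnly-independent {y} {z} {k} {k′} oy@(sy , Ky) oz@(sz , Kz) ly lz = ¬-not λ yz →
      ¬swappable (k , proj₁ (proj₁ ly) , y , z , (sy , Ky , missesOnly⇒adjacentToAllBut ly) ,
                  (sz , Kz , missesOnly⇒adjacentToAllBut (subst (MissesOnly z) (same-miss yz) lz)) , yz)
      where
      same-miss : adj G y z ≡ true → k′ ≡ k
      same-miss yz with misses-nested oy oz yz
      ... | inj₁ y⊆z = sym (proj₂ lz k (y⊆z k (proj₁ ly)))
      ... | inj₂ z⊆y = proj₂ ly k′ (z⊆y k′ (proj₁ lz))

    missesSeveral-not-nested : ∀ {y z} → Outside y → Outside z → adj G y z ≡ true → ¬ ∃ (MissesOnly y)
                             → ¬ (∀ a → Misses y a → Misses z a)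
    missesSeveral-not-nested oy oz yz ¬only y⊆z =
      let a , ya = misses-some oy
          b , yb , b≢a = misses-another ¬only ya
      in b≢a (sym (common-miss-unique oy oz yz ya (y⊆z a ya) yb (y⊆z b yb)))

    missesSeveral-independent : ∀ {y z} → Outside y → Outside z → ¬ ∃ (MissesOnly y) → ¬ ∃ (MissesOnly z)
                              → adj G y z ≡ false
    missesSeveral-independent oy oz ¬ly ¬lz = ¬-not λ yz →
      [ missesSeveral-not-nested oy oz yz ¬ly , missesSeveral-not-nested oz oy (adj-flip G yz) ¬lz ]′ (misses-nested oy oz yz)

    twoOnePartition : TwoOnePartition G S
    twoOnePartition = record
      { class        = class
      ; clique       = λ x y (_ , cx) (_ , cy) → K-complete x y (layer-0 _ _ cx) (layer-0 _ _ cy)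
      ; independent₁ = λ x y (sx , cx) (sy , cy) →
          let Kx , (_ , lx) = layer-1 _ _ cx ; Ky , (_ , ly) = layer-1 _ _ cy
          in missesOnly-independent (sx , Kx) (sy , Ky) lx ly
      ; independent₂ = λ x y (sx , cx) (sy , cy) →
          let Kx , ¬lx = layer-2 _ _ cx ; Ky , ¬ly = layer-2 _ _ cy
          in missesSeveral-independent (sx , Kx) (sy , Ky) ¬lx ¬ly
      }
      where
      class : Fin n → Fin 3
      class y = layer (K y) (missesOnly? y)

  pseudoSplit⇒twoOnePartition : PseudoSplitOn G S → TwoOnePartition G S
  pseudoSplit⇒twoOnePartition pseudoSplit =
    let _ , K-clique , ¬extendable , ¬swappable = locallyMaximalClique
    in LocallyMaximal.twoOnePartition pseudoSplit K-clique ¬extendable ¬swappable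

module Placements {n} (G : Graph n) (free2K2 : FreeOn G (Everything n) 2K2)
                  (freeK1+C4 : FreeOn G (Everything n) K1+C4) {u v} (uv : adj G u v ≡ true) where

  private
    neighbourhoodPartition : ∀ w → TwoOnePartition G (Neighbourhood G w)
    neighbourhoodPartition w = pseudoSplit⇒twoOnePartition G (λ x → adj G w x ≟ᵇ true)
                                 (neighbourhood-pseudoSplit G free2K2 freeK1+C4 w)
    module U = TwoOnePartition (neighbourhoodPartition u)
    module V = TwoOnePartition (neighbourhoodPartition v)

  data Placement (x : Fin n) : Fin 6 → Set where
    cliqueᵘ : adj G u x ≡ true → U.class x ≡ zero → Placement x zero
    firstᵘ  : adj G u x ≡ true → U.class x ≡ suc zero → Placement x (suc zero)
    secondᵘ : adj G u x ≡ true → U.class x ≡ suc (suc zero) → Placement x (suc (suc zero))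
    cliqueᵛ : adj G u x ≡ false → adj G v x ≡ true → V.class x ≡ zero → Placement x zero
    firstᵛ  : adj G u x ≡ false → adj G v x ≡ true → V.class x ≡ suc zero → Placement x (suc (suc (suc zero)))
    secondᵛ : adj G u x ≡ false → adj G v x ≡ true → V.class x ≡ suc (suc zero)
            → Placement x (suc (suc (suc (suc zero))))
    remote  : adj G u x ≡ false → adj G v x ≡ false → Placement x (suc (suc (suc (suc (suc zero)))))

  placement : ∀ x → ∃ (Placement x)
  placement x with adj G u x in ux | U.class x in cᵘ | adj G v x in vx | V.class x in cᵛ
  ... | true  | zero           | _     | _              = _ , cliqueᵘ ux cᵘ
  ... | true  | suc zero       | _     | _              = _ , firstᵘ ux cᵘ
  ... | true  | suc (suc zero) | _     | _              = _ , secondᵘ ux cᵘ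
  ... | false | _              | true  | zero           = _ , cliqueᵛ ux vx cᵛ
  ... | false | _              | true  | suc zero       = _ , firstᵛ ux vx cᵛ
  ... | false | _              | true  | suc (suc zero) = _ , secondᵛ ux vx cᵛ
  ... | false | _              | false | _              = _ , remote ux vx

  place : Fin n → Fin 6
  place x = proj₁ (placement x)

  placed : ∀ {x i} → place x ≡ i → Placement x i
  placed {x} e = subst (Placement x) e (proj₂ (placement x))

  place-coBipartite : BipartiteOn (complement G) (Part place zero)
  place-coBipartite = adj G u , λ x y px py x~y →
    let x≢y , ¬xy = complement-adj G x~y in sides (placed px) (placed py) x≢y ¬xy
    where
    sides : ∀ {x y} → Placement x zero → Placement y zero → x ≢ y → adj G x y ≡ false → adj G u x ≢ adj G u y
    sides (cliqueᵘ ux cx)    (cliqueᵘ uy cy)    x≢y ¬xy _ = ≡true⇒≢false (U.clique _ _ (ux , cx) (uy , cy) x≢y) ¬xy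
    sides (cliqueᵛ _ vx cx)  (cliqueᵛ _ vy cy)  x≢y ¬xy _ = ≡true⇒≢false (V.clique _ _ (vx , cx) (vy , cy) x≢y) ¬xy
    sides (cliqueᵘ ux _)     (cliqueᵛ uy _ _)   _   _   e = ≡true⇒≢false (trans (sym e) ux) uy
    sides (cliqueᵛ ux _ _)   (cliqueᵘ uy _)     _   _   e = ≡true⇒≢false (trans e uy) ux

  independent : ∀ {x y i} → Placement x (suc i) → Placement y (suc i) → adj G x y ≡ false
  independent (firstᵘ ux cx)    (firstᵘ uy cy)    = U.independent₁ _ _ (ux , cx) (uy , cy)
  independent (secondᵘ ux cx)   (secondᵘ uy cy)   = U.independent₂ _ _ (ux , cx) (uy , cy)
  independent (firstᵛ _ vx cx)  (firstᵛ _ vy cy)  = V.independent₁ _ _ (vx , cx) (vy , cy)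
  independent (secondᵛ _ vx cx) (secondᵛ _ vy cy) = V.independent₂ _ _ (vx , cx) (vy , cy)
  independent (remote ux vx)    (remote uy vy)    =
    ¬-not λ xy → free2K2 (2K2-induced G tt tt tt tt uv xy ux uy vx vy)

  place-independent : ∀ (i : Fin 5) → IndependentOn G (Part place (suc i))
  place-independent i x y px py = independent (placed px) (placed py)

theorem3p3 : ∀ {n} (G : Graph n) → Connected G
    → FreeOn G (Everything n) 2K2 → FreeOn G (Everything n) K1+C4
    → PseudoSplit G
      ⊎ Σ (Fin n → Fin 6) λ p →
          ( ( PseudoSplitOn G (Part p zero)
              × (∀ w₁ w → CliqueNumberOn G (Part p zero) w₁ → CliqueNumberOn G (Everything n) w → w₁ ≤ w ∸ 1)
              × (∀ v → p v ≢ suc (suc (suc (suc zero))))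
              × (∀ v → p v ≢ suc (suc (suc (suc (suc zero))))) )
            ⊎ BipartiteOn (complement G) (Part p zero) )
          × (∀ (i : Fin 5) → IndependentOn G (Part p (suc i)))
theorem3p3 G _ free2K2 freeK1+C4 with any? (λ u → any? λ v → adj G u v ≟ᵇ true)
... | no noEdge =
  inj₂ (const (suc zero) , inj₂ (const true , λ _ _ ()) , λ _ x y _ _ → ¬-not λ xy → noEdge (x , y , xy))
... | yes (u , v , uv) = inj₂ (place , inj₂ place-coBipartite , place-independent)
  where open Placements G free2K2 freeK1+C4 uv
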